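{- In the Balanced RePartitioning problem, no $\delta$-augmented deterministic online algorithm can achieve a competitive ratio smaller than $k$, as long as $\delta<\ell$.
   Context: Balanced RePartitioning (BRP): a set $V$ of $n=k\ell$ nodes is distributed among $\ell$ clusters. An online sequence $\sigma=\sigma_1,\sigma_2,\dots$ of communication requests arrives, each $\sigma_t=\{u_t,v_t\}$ a pair of nodes. Before serving each request the algorithm may repartition the nodes by migrating them between clusters (respecting cluster capacities), each node migration costing $\alpha\ge 1$. A request costs $0$ if its two nodes are in the same cluster when served and $1$ otherwise. The cost of an algorithm on $\sigma$ is its total migration plus communication cost. A $\delta$-augmented online algorithm has clusters of capacity $\delta k$ each (while still $n=k\ell$), and it is compared against the optimal offline algorithm $\textsc{Off}$, which knows $\sigma$ in advance and uses clusters of capacity $k$ (no augmentation); both start from the same initial placement. The competitive ratio of an online algorithm $\textsc{On}$ is $\max_\sigma \textsc{On}(\sigma)/\textsc{Off}(\sigma)$.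
   Formalization: The node migration cost α takes only rational values at least 1. -}

module Defs where

open import Data.Nat using (ℕ; zero; suc; _≤_)
open import Data.Fin using (Fin; _≟_)
open import Data.Fin.Base using ()
open import Data.List using (List; []; _∷_; length; filter; _++_; [_])
open import Data.List.Base using (allFin)
open import Data.Vec using (Vec; []; _∷_)
open import Data.Vec.Relation.Unary.All using (All)
open import Data.Product using (Σ; _×_; _,_; proj₁; proj₂)
open import Data.Bool using (if_then_else_)
open import Data.Integer using (+_)
open import Data.Rational using (ℚ; 0ℚ; _+_; _*_; _/_)
open import Relation.Nullary using (¬_; does; ¬?)
open import Relation.Binary.PropositionalEquality using (_≡_)

ℕ→ℚ : ℕ → ℚ
ℕ→ℚ m = + m / 1

Request : ℕ → Set
Request n = Σ (Fin n × Fin n) (λ uv → ¬ (proj₁ uv ≡ proj₂ uv))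

Placement : ℕ → ℕ → Set
Placement n ℓ = Fin n → Fin ℓ

load : ∀ {n ℓ} → Placement n ℓ → Fin ℓ → ℕ
load {n} p i = length (filter (λ x → p x ≟ i) (allFin n))

Respects : ∀ {n ℓ} → ℕ → Placement n ℓ → Set
Respects {ℓ = ℓ} cap p = (i : Fin ℓ) → load p i ≤ cap

migrations : ∀ {n ℓ} → Placement n ℓ → Placement n ℓ → ℕ
migrations {n} p q = length (filter (λ x → ¬? (p x ≟ q x)) (allFin n))

commCost : ∀ {n ℓ} → Placement n ℓ → Request n → ℕ
commCost p ((u , v) , _) = if does (p u ≟ p v) then 0 else 1

stepCost : ∀ {n ℓ} → ℚ → Placement n ℓ → Placement n ℓ → Request n → ℚ
stepCost α p q r = α * ℕ→ℚ (migrations p q) + ℕ→ℚ (commCost q r)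

-- a deterministic online algorithm with cluster capacity cap: given the past
-- requests and the current request, it chooses the placement used to serve
-- the current request (before serving it); it must respect the capacity.
record OnlineAlg (n ℓ cap : ℕ) : Set where
  field
    decide : List (Request n) → Request n → Placement n ℓ
    valid  : (h : List (Request n)) (r : Request n) → Respects cap (decide h r)

open OnlineAlg public

onRun : ∀ {n ℓ cap} → ℚ → OnlineAlg n ℓ cap → Placement n ℓ →
        List (Request n) → List (Request n) → ℚ
onRun α A p h [] = 0ℚ
onRun α A p h (r ∷ rs) = stepCost α p q r + onRun α A q (h ++ [ r ]) rs
  where q = decide A h r

onCost : ∀ {n ℓ cap} → ℚ → OnlineAlg n ℓ cap → Placement n ℓ → List (Request n) → ℚ
onCost α A p σ = onRun α A p [] σ

schedCost : ∀ {n ℓ} → ℚ → Placement n ℓ → (σ : List (Request n)) →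
            Vec (Placement n ℓ) (length σ) → ℚ
schedCost α p [] [] = 0ℚ
schedCost α p (r ∷ rs) (q ∷ qs) = stepCost α p q r + schedCost α q rs qs

module Submission where

-- The N = k · ℓ nodes form a k × ℓ grid, threaded by a snake path that runs
-- down each column (k nodes) and then on to the top of the next column.
-- • Online side: a placement with capacity cap < N cannot keep the whole path
--   in one cluster, so an adaptive adversary can always request a path edge
--   whose endpoints the online algorithm currently separates; the algorithm
--   then pays at least 1 per request (communication, or a migration of α ≥ 1).
-- • Offline side: there are k static placements ("layers") of capacity k such
--   that each path edge is cut by at most one of them.  Averaging over them,
--   some layer cuts at most T / k of T adversarial requests, so the offline
--   cost is at most α · N (moving once to that layer) + T / k.
-- Choosing T large makes the additive α · N negligible, beating any c < k.

open import Defs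
open import Data.Nat as ℕ using (ℕ; zero; suc; _≤_; _<_; z≤n; s≤s; _*_; _<?_)
import Data.Nat.Properties as ℕP
open import Data.Nat.Coprimality as Coprime using (1-coprimeTo)
open import Data.Integer as ℤ using (+_; -[1+_])
import Data.Integer.Properties as ℤP
open import Data.Rational as ℚ using (ℚ; mkℚ; 0ℚ; 1ℚ; *≤*; *<*; 1/_; Positive; positive; nonNegative; nonPositive)
import Data.Rational.Properties as ℚP
open import Data.Rational.Solver using (module +-*-Solver)
open import Data.Fin using (Fin; zero; suc; _≟_; toℕ; inject₁; fromℕ; punchIn; combine; remQuot)
open import Data.Fin.Properties using (suc-injective; injective⇒≤; punchIn-injective; punchInᵢ≢i; all?; ¬∀⟶∃¬; toℕ-injective; toℕ-inject₁; toℕ-fromℕ; toℕ≤pred[n]; remQuot-combine; combine-remQuot)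
open import Data.List using (List; []; _∷_; length; filter; allFin; _++_; [_])
open import Data.List.Properties using (length-tabulate; filter-all; filter-none; filter-some; length-filter)
import Data.List.Relation.Unary.All as ListAll
import Data.List.Relation.Unary.All.Properties as ListAll
import Data.List.Relation.Unary.Any as ListAny
import Data.List.Relation.Unary.Unique.Propositional as ListUnique
open import Data.List.Relation.Unary.AllPairs using ([]; _∷_)
import Data.List.Relation.Unary.Unique.Propositional.Properties as ListUnique
open import Data.List.Membership.Propositional.Properties using (∈-allFin)
open import Data.Vec as Vec using (Vec)
import Data.Vec.Relation.Unary.All as VecAll
import Data.Vec.Relation.Unary.All.Properties as VecAll
import Data.Vec.Relation.Unary.Unique.Propositional as VecUnique
open import Data.Vec.Relation.Unary.AllPairs using ([]; _∷_)
import Data.Vec.Relation.Unary.Unique.Propositional.Properties as VecUnique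
open import Algebra.Properties.CommutativeMonoid.Sum ℕP.+-0-commutativeMonoid using (sum; sum-cong-≗; sum-replicate-zero; ∑-distrib-+)
open import Function using (_∘_)
open import Relation.Nullary using (¬_; Dec; yes; no; ¬?)
open import Data.Product using (Σ; ∃; _×_; _,_; proj₁; proj₂)
open import Data.Sum using (inj₁; inj₂)
open import Data.Empty using (⊥-elim)
open import Relation.Binary.PropositionalEquality using (_≡_; refl; sym; trans; cong; cong₂; subst; subst₂; module ≡-Reasoning)

ℕ→ℚ-normal : ∀ m → ℕ→ℚ m ≡ mkℚ (+ m) 0 (Coprime.sym (1-coprimeTo m))
ℕ→ℚ-normal m = ℚP.normalize-coprime {m} {0} (Coprime.sym (1-coprimeTo m))

ℕ→ℚ-+ : ∀ a b → ℕ→ℚ (a ℕ.+ b) ≡ ℕ→ℚ a ℚ.+ ℕ→ℚ b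
ℕ→ℚ-+ a b = trans (ℚP./-cong {+ (a ℕ.+ b)} {1} numerators refl)
                  (sym (cong₂ ℚ._+_ (ℕ→ℚ-normal a) (ℕ→ℚ-normal b)))
  where
  numerators : + (a ℕ.+ b) ≡ + a ℤ.* + 1 ℤ.+ + b ℤ.* + 1
  numerators = trans (ℤP.pos-+ a b) (sym (cong₂ ℤ._+_ (ℤP.*-identityʳ (+ a)) (ℤP.*-identityʳ (+ b))))

ℕ→ℚ-* : ∀ a b → ℕ→ℚ (a * b) ≡ ℕ→ℚ a ℚ.* ℕ→ℚ b
ℕ→ℚ-* a b = trans (ℚP./-cong {+ (a * b)} {1} (ℤP.pos-* a b) refl)
                  (sym (cong₂ ℚ._*_ (ℕ→ℚ-normal a) (ℕ→ℚ-normal b)))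

ℕ→ℚ-mono-≤ : ∀ {a b} → a ≤ b → ℕ→ℚ a ℚ.≤ ℕ→ℚ b
ℕ→ℚ-mono-≤ {a} {b} a≤b = subst₂ ℚ._≤_ (sym (ℕ→ℚ-normal a)) (sym (ℕ→ℚ-normal b))
  (*≤* (subst₂ ℤ._≤_ (sym (ℤP.*-identityʳ (+ a))) (sym (ℤP.*-identityʳ (+ b))) (ℤ.+≤+ a≤b)))

ℕ→ℚ-mono-< : ∀ {a b} → a < b → ℕ→ℚ a ℚ.< ℕ→ℚ b
ℕ→ℚ-mono-< {a} {b} a<b = subst₂ ℚ._<_ (sym (ℕ→ℚ-normal a)) (sym (ℕ→ℚ-normal b))
  (*<* (subst₂ ℤ._<_ (sym (ℤP.*-identityʳ (+ a))) (sym (ℤP.*-identityʳ (+ b))) (ℤ.+<+ a<b)))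

ℕ→ℚ-nonNeg : ∀ a → 0ℚ ℚ.≤ ℕ→ℚ a
ℕ→ℚ-nonNeg a = ℕ→ℚ-mono-≤ {0} {a} z≤n

archimedean : ∀ p → ∃ λ M → p ℚ.< ℕ→ℚ (suc M)
archimedean (mkℚ (+ m) d c) = m , subst (mkℚ (+ m) d c ℚ.<_) (sym (ℕ→ℚ-normal (suc m)))
  (*<* (subst₂ ℤ._<_ (sym (ℤP.*-identityʳ (+ m))) (ℤP.pos-* (suc m) (suc d))
     (ℤ.+<+ (s≤s (ℕP.≤-trans (ℕP.m≤m*n m (suc d)) (ℕP.m≤n+m (m * suc d) d))))))
archimedean (mkℚ -[1+ m ] d c) = 0 , subst (mkℚ -[1+ m ] d c ℚ.<_) (sym (ℕ→ℚ-normal 1))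
  (*<* (subst (ℤ._< + 1 ℤ.* + suc d) (sym (ℤP.*-identityʳ -[1+ m ])) ℤ.-<+))

archimedean-scaled : ∀ q d → .{{_ : Positive d}} → ∃ λ M → q ℚ.< d ℚ.* ℕ→ℚ (suc M)
archimedean-scaled q d = M , subst (ℚ._< d ℚ.* ℕ→ℚ (suc M)) d*[q/d]≡q (ℚP.*-monoʳ-<-pos d q/d<M)
  where
  instance _ = ℚP.pos⇒nonZero d
  M : ℕ
  M = proj₁ (archimedean (q ℚ.* 1/ d))
  q/d<M : q ℚ.* 1/ d ℚ.< ℕ→ℚ (suc M)
  q/d<M = proj₂ (archimedean (q ℚ.* 1/ d))
  d*[q/d]≡q : d ℚ.* (q ℚ.* 1/ d) ≡ q
  d*[q/d]≡q = trans (cong (d ℚ.*_) (ℚP.*-comm q (1/ d)))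
               (trans (sym (ℚP.*-assoc d (1/ d) q))
                (trans (cong (ℚ._* q) (ℚP.*-inverseʳ d)) (ℚP.*-identityˡ q)))

recombine : ∀ k c m → (k ℚ.- c) ℚ.* m ℚ.+ c ℚ.* m ≡ k ℚ.* m
recombine = solve 3 (λ k c m → (k :- c) :* m :+ c :* m := k :* m) refl
  where open +-*-Solver

-- The amortisation behind the theorem: for c < K, a fixed overhead B is
-- swamped by a long enough run, c · x < K · M for every cost 0 ≤ x ≤ B + M.
enough-rounds : ∀ K' (c B : ℚ) → c ℚ.< ℕ→ℚ (suc K') →
  ∃ λ M → ∀ x → 0ℚ ℚ.≤ x → x ℚ.≤ B ℚ.+ ℕ→ℚ (suc M) → c ℚ.* x ℚ.< ℕ→ℚ (suc K' * suc M)
enough-rounds K' c B c<K with ℚP.≤-total c 0ℚ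
... | inj₁ c≤0 = 0 , λ x 0≤x _ → begin-strict
  c ℚ.* x          ≤⟨ ℚP.*-monoˡ-≤-nonPos c {{nonPositive c≤0}} 0≤x ⟩
  c ℚ.* 0ℚ         ≡⟨ ℚP.*-zeroʳ c ⟩
  0ℚ               <⟨ ℕ→ℚ-mono-< {0} {suc K' * 1} (s≤s z≤n) ⟩
  ℕ→ℚ (suc K' * 1) ∎
  where open ℚP.≤-Reasoning
... | inj₂ 0≤c = M , bound
  where
  K : ℚ
  K = ℕ→ℚ (suc K')
  d : ℚ
  d = K ℚ.- c
  instance _ : Positive d
           _ = positive (subst (ℚ._< d) (ℚP.+-inverseʳ c) (ℚP.+-monoˡ-< (ℚ.- c) c<K))
  M : ℕ
  M = proj₁ (archimedean-scaled (c ℚ.* B) d)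
  cB<dM : c ℚ.* B ℚ.< d ℚ.* ℕ→ℚ (suc M)
  cB<dM = proj₂ (archimedean-scaled (c ℚ.* B) d)
  bound : ∀ x → 0ℚ ℚ.≤ x → x ℚ.≤ B ℚ.+ ℕ→ℚ (suc M) → c ℚ.* x ℚ.< ℕ→ℚ (suc K' * suc M)
  bound x _ x≤B+M = begin-strict
    c ℚ.* x                                 ≤⟨ ℚP.*-monoˡ-≤-nonNeg c {{nonNegative 0≤c}} x≤B+M ⟩
    c ℚ.* (B ℚ.+ ℕ→ℚ (suc M))               ≡⟨ ℚP.*-distribˡ-+ c B (ℕ→ℚ (suc M)) ⟩
    c ℚ.* B ℚ.+ c ℚ.* ℕ→ℚ (suc M)           <⟨ ℚP.+-monoˡ-< (c ℚ.* ℕ→ℚ (suc M)) cB<dM ⟩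
    d ℚ.* ℕ→ℚ (suc M) ℚ.+ c ℚ.* ℕ→ℚ (suc M) ≡⟨ recombine K c (ℕ→ℚ (suc M)) ⟩
    K ℚ.* ℕ→ℚ (suc M)                       ≡⟨ sym (ℕ→ℚ-* (suc K') (suc M)) ⟩
    ℕ→ℚ (suc K' * suc M)                    ∎
    where open ℚP.≤-Reasoning

fromList-unique : ∀ {A : Set} {xs : List A} → ListUnique.Unique xs → VecUnique.Unique (Vec.fromList xs)
fromList-unique [] = []
fromList-unique (x∉xs ∷ xs-unique) = VecAll.fromList⁺ x∉xs ∷ fromList-unique xs-unique

-- A cluster whose nodes are told apart by some map e into Fin m holds at most
-- m nodes: e is injective on the (duplicate-free) list of the cluster's nodes.
load-≤ : ∀ {n ℓ m} (p : Placement n ℓ) (i : Fin ℓ) (e : Fin n → Fin m) →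
         (∀ {x y} → p x ≡ i → p y ≡ i → e x ≡ e y → x ≡ y) → load p i ≤ m
load-≤ {n} p i e separates = injective⇒≤ {f = e ∘ Vec.lookup nodes} injective
  where
  nodes : Vec (Fin n) (load p i)
  nodes = Vec.fromList (filter (λ x → p x ≟ i) (allFin n))
  in-cluster : ∀ a → p (Vec.lookup nodes a) ≡ i
  in-cluster = VecAll.lookup⁺ (VecAll.fromList⁺ (ListAll.all-filter (λ x → p x ≟ i) (allFin n)))
  nodes-unique : VecUnique.Unique nodes
  nodes-unique = fromList-unique (ListUnique.filter⁺ (λ x → p x ≟ i) (ListUnique.allFin⁺ n))
  injective : ∀ {a b} → e (Vec.lookup nodes a) ≡ e (Vec.lookup nodes b) → a ≡ b
  injective {a} {b} eq = VecUnique.lookup-injective nodes-unique a b (separates (in-cluster a) (in-cluster b) eq)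

load-everything : ∀ {n ℓ} (p : Placement n ℓ) i → (∀ x → p x ≡ i) → load p i ≡ n
load-everything {n} p i all-in-i =
  trans (cong length (filter-all (λ x → p x ≟ i) (ListAll.universal all-in-i (allFin n))))
        (length-tabulate {n = n} (λ x → x))

migrations-refl : ∀ {n ℓ} (q : Placement n ℓ) → migrations q q ≡ 0
migrations-refl {n} q =
  cong length (filter-none (λ x → ¬? (q x ≟ q x)) (ListAll.universal (λ x q≢q → q≢q refl) (allFin n)))

migrations-≤ : ∀ {n ℓ} (p q : Placement n ℓ) → migrations p q ≤ n
migrations-≤ {n} p q = subst (migrations p q ≤_) (length-tabulate {n = n} (λ x → x))
  (length-filter (λ x → ¬? (p x ≟ q x)) (allFin n))

migrations-pos : ∀ {n ℓ} (p q : Placement n ℓ) x → ¬ p x ≡ q x → 1 ≤ migrations p q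
migrations-pos p q x moved = filter-some (λ x → ¬? (p x ≟ q x)) (ListAny.map (λ { refl → moved }) (∈-allFin x))

sum-zero : ∀ {n} (f : Fin n → ℕ) → (∀ j → f j ≡ 0) → sum f ≡ 0
sum-zero {n} f f≡0 = trans (sum-cong-≗ f≡0) (sum-replicate-zero n)

sum-concentrated : ∀ {n} (f : Fin n → ℕ) i → (∀ j → ¬ j ≡ i → f j ≡ 0) → sum f ≡ f i
sum-concentrated f zero others =
  trans (cong (f zero ℕ.+_) (sum-zero (f ∘ suc) (λ j → others (suc j) (λ ())))) (ℕP.+-identityʳ (f zero))
sum-concentrated f (suc i) others =
  trans (cong (ℕ._+ sum (f ∘ suc)) (others zero (λ ())))
        (sum-concentrated (f ∘ suc) i (λ j j≢i → others (suc j) (j≢i ∘ suc-injective)))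

sum-≥ : ∀ {n} (f : Fin n → ℕ) c → (∀ j → c ≤ f j) → n * c ≤ sum f
sum-≥ {zero} f c c≤f = z≤n
sum-≥ {suc n} f c c≤f = ℕP.+-mono-≤ (c≤f zero) (sum-≥ (f ∘ suc) c (c≤f ∘ suc))

averaging : ∀ {n} (f : Fin (suc n) → ℕ) M → sum f ≤ suc n * M → ∃ λ j → f j ≤ M
averaging {n} f M sum≤ with all? (λ j → M <? f j)
... | yes all-above = ⊥-elim (ℕP.<⇒≱ (ℕP.*-monoʳ-< (suc n) (ℕP.n<1+n M))
                              (ℕP.≤-trans (sum-≥ f (suc M) all-above) sum≤))
... | no not-all with ¬∀⟶∃¬ (suc n) (λ j → M < f j) (λ j → M <? f j) not-all
...   | j , not-above = j , ℕP.≮⇒≥ not-above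

Separates : ∀ {n ℓ} → Placement n ℓ → Request n → Set
Separates p ((u , v) , _) = ¬ p u ≡ p v

reunion-migrates : ∀ {n ℓ} (p q : Placement n ℓ) r → Separates p r → ¬ Separates q r → 1 ≤ migrations p q
reunion-migrates p q ((u , v) , _) apart not-apart with p u ≟ q u | q u ≟ q v
... | _          | no q-apart = ⊥-elim (not-apart q-apart)
... | no u-moved | yes _      = migrations-pos p q u u-moved
... | yes u-kept | yes joined = migrations-pos p q v (λ v-kept → apart (trans u-kept (trans joined (sym v-kept))))

commCost-separated : ∀ {n ℓ} (q : Placement n ℓ) r → Separates q r → commCost q r ≡ 1
commCost-separated q ((u , v) , _) apart with q u ≟ q v
... | yes together = ⊥-elim (apart together)
... | no _ = refl

commCost-together : ∀ {n ℓ} (q : Placement n ℓ) r → ¬ Separates q r → commCost q r ≡ 0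
commCost-together q ((u , v) , _) not-apart with q u ≟ q v
... | yes _ = refl
... | no apart = ⊥-elim (not-apart apart)

commCost-≤1 : ∀ {n ℓ} (q : Placement n ℓ) r → commCost q r ≤ 1
commCost-≤1 q ((u , v) , _) with q u ≟ q v
... | yes _ = z≤n
... | no _ = s≤s z≤n

cuts : ∀ {n ℓ} → Placement n ℓ → List (Request n) → ℕ
cuts q [] = 0
cuts q (r ∷ rs) = commCost q r ℕ.+ cuts q rs

module Costs (α : ℚ) (1≤α : 1ℚ ℚ.≤ α) where

  -- α ≥ 1 in particular makes α nonnegative, as the monotonicity lemmas require
  instance
    α-nonNeg : ℚ.NonNegative α
    α-nonNeg = nonNegative (ℚP.≤-trans (ℕ→ℚ-mono-≤ {0} {1} z≤n) 1≤α)

  ≤-+-nonNeg : ∀ x y → 0ℚ ℚ.≤ y → x ℚ.≤ x ℚ.+ y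
  ≤-+-nonNeg x y 0≤y = subst (ℚ._≤ x ℚ.+ y) (ℚP.+-identityʳ x) (ℚP.+-monoʳ-≤ x 0≤y)

  migrationCost-mono : ∀ {a b} → a ≤ b → α ℚ.* ℕ→ℚ a ℚ.≤ α ℚ.* ℕ→ℚ b
  migrationCost-mono a≤b = ℚP.*-monoˡ-≤-nonNeg α (ℕ→ℚ-mono-≤ a≤b)

  migrationCost-nonNeg : ∀ m → 0ℚ ℚ.≤ α ℚ.* ℕ→ℚ m
  migrationCost-nonNeg m = subst (ℚ._≤ α ℚ.* ℕ→ℚ m) (ℚP.*-zeroʳ α) (migrationCost-mono {0} {m} z≤n)

  stepCost-nonNeg : ∀ {n ℓ} (p q : Placement n ℓ) r → 0ℚ ℚ.≤ stepCost α p q r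
  stepCost-nonNeg p q r = ℚP.≤-trans (migrationCost-nonNeg (migrations p q))
    (≤-+-nonNeg _ _ (ℕ→ℚ-nonNeg (commCost q r)))

  schedCost-nonNeg : ∀ {n ℓ} (p : Placement n ℓ) σ S → 0ℚ ℚ.≤ schedCost α p σ S
  schedCost-nonNeg p [] Vec.[] = ℚP.≤-refl
  schedCost-nonNeg p (r ∷ rs) (q Vec.∷ qs) =
    ℚP.≤-trans (stepCost-nonNeg p q r) (≤-+-nonNeg _ _ (schedCost-nonNeg q rs qs))

  -- Serving a request whose endpoints are separated beforehand costs at least 1:
  -- either they stay separated (communication 1) or a node moves (migration α ≥ 1).
  stepCost-separated : ∀ {n ℓ} (p q : Placement n ℓ) r → Separates p r → 1ℚ ℚ.≤ stepCost α p q r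
  stepCost-separated p q r@((u , v) , _) apart = by-cases (q u ≟ q v)
    where
    open ℚP.≤-Reasoning
    by-cases : Dec (q u ≡ q v) → 1ℚ ℚ.≤ stepCost α p q r
    by-cases (no q-apart) = begin
      1ℚ                                         ≡⟨ sym (ℚP.+-identityˡ 1ℚ) ⟩
      0ℚ ℚ.+ 1ℚ                                  ≤⟨ ℚP.+-monoˡ-≤ 1ℚ (migrationCost-nonNeg (migrations p q)) ⟩
      α ℚ.* ℕ→ℚ (migrations p q) ℚ.+ ℕ→ℚ 1       ≡⟨ cong (λ c → α ℚ.* ℕ→ℚ (migrations p q) ℚ.+ ℕ→ℚ c)
                                                       (sym (commCost-separated q r q-apart)) ⟩
      stepCost α p q r                           ∎
    by-cases (yes together) = begin
      1ℚ                                         ≤⟨ 1≤α ⟩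
      α                                          ≡⟨ sym (ℚP.*-identityʳ α) ⟩
      α ℚ.* ℕ→ℚ 1                                ≤⟨ migrationCost-mono (reunion-migrates p q r apart (λ q-apart → q-apart together)) ⟩
      α ℚ.* ℕ→ℚ (migrations p q)                 ≤⟨ ≤-+-nonNeg _ _ (ℕ→ℚ-nonNeg (commCost q r)) ⟩
      stepCost α p q r                           ∎

  stayCost : ∀ {n ℓ} (q : Placement n ℓ) σ → schedCost α q σ (Vec.replicate (length σ) q) ≡ ℕ→ℚ (cuts q σ)
  stayCost q [] = refl
  stayCost q (r ∷ rs) = begin
    (α ℚ.* ℕ→ℚ (migrations q q) ℚ.+ ℕ→ℚ (commCost q r)) ℚ.+ schedCost α q rs (Vec.replicate (length rs) q)
      ≡⟨ cong₂ (λ m c → (α ℚ.* ℕ→ℚ m ℚ.+ ℕ→ℚ (commCost q r)) ℚ.+ c) (migrations-refl q) (stayCost q rs) ⟩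
    (α ℚ.* 0ℚ ℚ.+ ℕ→ℚ (commCost q r)) ℚ.+ ℕ→ℚ (cuts q rs)
      ≡⟨ cong (λ z → (z ℚ.+ ℕ→ℚ (commCost q r)) ℚ.+ ℕ→ℚ (cuts q rs)) (ℚP.*-zeroʳ α) ⟩
    (0ℚ ℚ.+ ℕ→ℚ (commCost q r)) ℚ.+ ℕ→ℚ (cuts q rs)
      ≡⟨ cong (ℚ._+ ℕ→ℚ (cuts q rs)) (ℚP.+-identityˡ (ℕ→ℚ (commCost q r))) ⟩
    ℕ→ℚ (commCost q r) ℚ.+ ℕ→ℚ (cuts q rs)
      ≡⟨ sym (ℕ→ℚ-+ (commCost q r) (cuts q rs)) ⟩
    ℕ→ℚ (cuts q (r ∷ rs)) ∎
    where open ≡-Reasoning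

  staticCost : ∀ {n ℓ} (p q : Placement n ℓ) σ →
    schedCost α p σ (Vec.replicate (length σ) q) ℚ.≤ α ℚ.* ℕ→ℚ n ℚ.+ ℕ→ℚ (cuts q σ)
  staticCost {n} p q [] = ℚP.≤-trans (migrationCost-nonNeg n) (≤-+-nonNeg _ _ ℚP.≤-refl)
  staticCost {n} p q (r ∷ rs) = begin
    stepCost α p q r ℚ.+ schedCost α q rs (Vec.replicate (length rs) q)
      ≡⟨ cong (stepCost α p q r ℚ.+_) (stayCost q rs) ⟩
    (α ℚ.* ℕ→ℚ (migrations p q) ℚ.+ ℕ→ℚ (commCost q r)) ℚ.+ ℕ→ℚ (cuts q rs)
      ≡⟨ ℚP.+-assoc (α ℚ.* ℕ→ℚ (migrations p q)) (ℕ→ℚ (commCost q r)) (ℕ→ℚ (cuts q rs)) ⟩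
    α ℚ.* ℕ→ℚ (migrations p q) ℚ.+ (ℕ→ℚ (commCost q r) ℚ.+ ℕ→ℚ (cuts q rs))
      ≡⟨ cong (α ℚ.* ℕ→ℚ (migrations p q) ℚ.+_) (sym (ℕ→ℚ-+ (commCost q r) (cuts q rs))) ⟩
    α ℚ.* ℕ→ℚ (migrations p q) ℚ.+ ℕ→ℚ (cuts q (r ∷ rs))
      ≤⟨ ℚP.+-monoˡ-≤ (ℕ→ℚ (cuts q (r ∷ rs))) (migrationCost-mono (migrations-≤ p q)) ⟩
    α ℚ.* ℕ→ℚ n ℚ.+ ℕ→ℚ (cuts q (r ∷ rs)) ∎
    where open ℚP.≤-Reasoning

-- An adaptive adversary against a deterministic online algorithm A: it always
-- requests a pair that A's current placement separates, so A pays at least 1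
-- per request, whatever it does.
module AdaptiveAdversary {n ℓ cap} (α : ℚ) (1≤α : 1ℚ ℚ.≤ α) (A : OnlineAlg n ℓ cap)
  (request : (p : Placement n ℓ) → Respects cap p → Request n)
  (request-separated : ∀ p p-ok → Separates p (request p p-ok)) where

  open Costs α 1≤α

  adversarial : ℕ → (p : Placement n ℓ) → Respects cap p → List (Request n) → List (Request n)
  adversarial zero p p-ok h = []
  adversarial (suc T) p p-ok h = r ∷ adversarial T (decide A h r) (valid A h r) (h ++ [ r ])
    where
    r : Request n
    r = request p p-ok

  adversarial-length : ∀ T p p-ok h → length (adversarial T p p-ok h) ≡ T
  adversarial-length zero p p-ok h = refl
  adversarial-length (suc T) p p-ok h = cong suc (adversarial-length T _ _ _)

  adversarial-all : ∀ {Q : Request n → Set} → (∀ p p-ok → Q (request p p-ok)) →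
                    ∀ T p p-ok h → ListAll.All Q (adversarial T p p-ok h)
  adversarial-all Q-request zero p p-ok h = ListAll.[]
  adversarial-all Q-request (suc T) p p-ok h =
    Q-request p p-ok ListAll.∷ adversarial-all Q-request T _ _ _

  online-≥-rounds : ∀ T p p-ok h → ℕ→ℚ T ℚ.≤ onRun α A p h (adversarial T p p-ok h)
  online-≥-rounds zero p p-ok h = ℚP.≤-refl
  online-≥-rounds (suc T) p p-ok h =
    subst (ℚ._≤ onRun α A p h (adversarial (suc T) p p-ok h)) (sym (ℕ→ℚ-+ 1 T))
      (ℚP.+-mono-≤ (stepCost-separated p q r (request-separated p p-ok))
                   (online-≥-rounds T q (valid A h r) (h ++ [ r ])))
    where
    r : Request n
    r = request p p-ok
    q : Placement n ℓ
    q = decide A h r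

-- the cyclic successor c ↦ c + 1 (mod m + 1)
rotate : ∀ {m} → Fin (suc m) → Fin (suc m)
rotate {zero} zero = zero
rotate {suc m} zero = suc zero
rotate {suc m} (suc c) = punchIn (suc zero) (rotate c)

rotate-injective : ∀ {m} {c d : Fin (suc m)} → rotate c ≡ rotate d → c ≡ d
rotate-injective {zero} {zero} {zero} _ = refl
rotate-injective {suc m} {zero} {zero} _ = refl
rotate-injective {suc m} {zero} {suc d} eq = ⊥-elim (punchInᵢ≢i (suc zero) (rotate d) (sym eq))
rotate-injective {suc m} {suc c} {zero} eq = ⊥-elim (punchInᵢ≢i (suc zero) (rotate c) eq)
rotate-injective {suc m} {suc c} {suc d} eq =
  cong suc (rotate-injective (punchIn-injective (suc zero) (rotate c) (rotate d) eq))

rotate-inject₁ : ∀ {m} (c : Fin m) → rotate (inject₁ c) ≡ suc c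
rotate-inject₁ {suc m} zero = refl
rotate-inject₁ {suc m} (suc c) = cong (punchIn (suc zero)) (rotate-inject₁ c)

consecutive-constant : ∀ {X : Set} {m} (f : Fin (suc m) → X) →
  (∀ i → f (inject₁ i) ≡ f (suc i)) → ∀ a → f a ≡ f zero
consecutive-constant f steps zero = refl
consecutive-constant {m = suc m} f steps (suc a) =
  trans (consecutive-constant (f ∘ suc) (steps ∘ suc) a) (sym (steps zero))

-- In the j-th offline placement the grid cell in row a, column c goes to
-- cluster c if a < j, and to the rotated cluster c + 1 if a ≥ j.
layer : ∀ {m} → ℕ → ℕ → Fin (suc m) → Fin (suc m)
layer j a c with a <? j
... | yes _ = c
... | no _ = rotate c

-- within one row the layer is injective, so a cluster gets at most one cell per row
layer-injective : ∀ {m} j a {c d : Fin (suc m)} → layer j a c ≡ layer j a d → c ≡ d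
layer-injective j a eq with a <? j
... | yes _ = eq
... | no _ = rotate-injective eq

layer-step : ∀ {m} j a (c : Fin (suc m)) → ¬ j ≡ suc a → layer j a c ≡ layer j (suc a) c
layer-step j a c j≢1+a with a <? j | suc a <? j
... | yes _   | yes _    = refl
... | no _    | no _     = refl
... | yes a<j | no 1+a≮j = ⊥-elim (j≢1+a (ℕP.≤-antisym (ℕP.≮⇒≥ 1+a≮j) a<j))
... | no a≮j  | yes 1+a<j = ⊥-elim (a≮j (ℕP.<-trans (ℕP.n<1+n a) 1+a<j))

layer-above : ∀ {m} j a (c : Fin (suc m)) → a < j → layer j a c ≡ c
layer-above j a c a<j with a <? j
... | yes _ = refl
... | no a≮j = ⊥-elim (a≮j a<j)

layer-below : ∀ {m} j a (c : Fin (suc m)) → ¬ a < j → layer j a c ≡ rotate c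
layer-below j a c a≮j with a <? j
... | yes a<j = ⊥-elim (a≮j a<j)
... | no _ = refl

-- The instance behind the bound: N = K · L nodes form a K × L grid (rows Fin K,
-- columns Fin L), threaded by a snake path running down each column and then
-- jumping to the top of the next one.
module Snake (k' ℓ' : ℕ) where

  K L N : ℕ
  K = suc k'
  L = suc ℓ'
  N = K * L

  cell : Fin K → Fin L → Fin N
  cell = combine

  row : Fin N → Fin K
  row x = proj₁ (remQuot {K} L x)

  column : Fin N → Fin L
  column x = proj₂ (remQuot {K} L x)

  cell-row-column : ∀ x → cell (row x) (column x) ≡ x
  cell-row-column x = combine-remQuot {K} L x

  offline : Fin K → Placement N L
  offline j x = layer (toℕ j) (toℕ (row x)) (column x)

  offline-cell : ∀ j a c → offline j (cell a c) ≡ layer (toℕ j) (toℕ a) c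
  offline-cell j a c = cong (λ ac → layer (toℕ j) (toℕ (proj₁ ac)) (proj₂ ac)) (remQuot-combine a c)

  -- each cluster receives at most one cell per row, hence at most K nodes
  offline-respects : ∀ j → Respects K (offline j)
  offline-respects j i = load-≤ (offline j) i row same-row-same-node
    where
    same-row-same-node : ∀ {x y} → offline j x ≡ i → offline j y ≡ i → row x ≡ row y → x ≡ y
    same-row-same-node {x} {y} x∈i y∈i same-row = begin
      x                       ≡⟨ sym (cell-row-column x) ⟩
      cell (row x) (column x) ≡⟨ cong₂ cell same-row same-column ⟩
      cell (row y) (column y) ≡⟨ cell-row-column y ⟩
      y                       ∎
      where
      open ≡-Reasoning
      same-column : column x ≡ column y
      same-column = layer-injective (toℕ j) (toℕ (row x))
        (trans x∈i (trans (sym y∈i) (cong (λ a → layer (toℕ j) (toℕ a) (column y)) (sym same-row))))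

  data Edge : Set where
    down : Fin k' → Fin L → Edge
    jump : Fin ℓ' → Edge

  source target : Edge → Fin N
  source (down a c) = cell (inject₁ a) c
  source (jump c) = cell (fromℕ k') (inject₁ c)
  target (down a c) = cell (suc a) c
  target (jump c) = cell zero (suc c)

  -- the only offline placement that may cut an edge
  cutter : Edge → Fin K
  cutter (down a c) = suc a
  cutter (jump c) = zero

  offline-keeps : ∀ e j → ¬ j ≡ cutter e → offline j (source e) ≡ offline j (target e)
  offline-keeps (down a c) j j≢1+a = begin
    offline j (cell (inject₁ a) c)    ≡⟨ offline-cell j (inject₁ a) c ⟩
    layer (toℕ j) (toℕ (inject₁ a)) c ≡⟨ cong (λ t → layer (toℕ j) t c) (toℕ-inject₁ a) ⟩
    layer (toℕ j) (toℕ a) c           ≡⟨ layer-step (toℕ j) (toℕ a) c (j≢1+a ∘ toℕ-injective) ⟩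
    layer (toℕ j) (suc (toℕ a)) c     ≡⟨ sym (offline-cell j (suc a) c) ⟩
    offline j (cell (suc a) c)        ∎
    where open ≡-Reasoning
  offline-keeps (jump c) j j≢0 = begin
    offline j (cell (fromℕ k') (inject₁ c))       ≡⟨ offline-cell j (fromℕ k') (inject₁ c) ⟩
    layer (toℕ j) (toℕ (fromℕ k')) (inject₁ c)    ≡⟨ layer-below (toℕ j) (toℕ (fromℕ k')) (inject₁ c) last-row-not-above ⟩
    rotate (inject₁ c)                            ≡⟨ rotate-inject₁ c ⟩
    suc c                                         ≡⟨ sym (layer-above (toℕ j) 0 (suc c) first-row-above) ⟩
    layer (toℕ j) 0 (suc c)                       ≡⟨ sym (offline-cell j zero (suc c)) ⟩
    offline j (cell zero (suc c))                 ∎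
    where
    open ≡-Reasoning
    last-row-not-above : ¬ toℕ (fromℕ k') < toℕ j
    last-row-not-above k'<j = ℕP.<⇒≱ (subst (_< toℕ j) (toℕ-fromℕ k') k'<j) (toℕ≤pred[n] j)
    first-row-above : 0 < toℕ j
    first-row-above = ℕP.n≢0⇒n>0 (j≢0 ∘ toℕ-injective)

  path-connected : (p : Placement N L) → (∀ e → p (source e) ≡ p (target e)) →
                   ∀ x → p x ≡ p (cell zero zero)
  path-connected p kept x = trans (cong p (sym (cell-row-column x))) (to-origin (row x) (column x))
    where
    to-top : ∀ a c → p (cell a c) ≡ p (cell zero c)
    to-top a c = consecutive-constant (λ a → p (cell a c)) (λ a → kept (down a c)) a
    to-origin : ∀ a c → p (cell a c) ≡ p (cell zero zero)
    to-origin a c = trans (to-top a c) (consecutive-constant (λ c → p (cell zero c))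
      (λ c → trans (sym (to-top (fromℕ k') (inject₁ c))) (kept (jump c))) c)

  CutBy : Placement N L → Set
  CutBy p = ∃ λ e → ¬ p (source e) ≡ p (target e)

  kept? : (p : Placement N L) (e : Edge) → Dec (p (source e) ≡ p (target e))
  kept? p e = p (source e) ≟ p (target e)

  find-cut : (p : Placement N L) → ¬ (∀ e → p (source e) ≡ p (target e)) → CutBy p
  find-cut p not-all-kept with all? (kept? p ∘ jump) | all? (λ a → all? (kept? p ∘ down a))
  ... | no some-jump-cut | _ with ¬∀⟶∃¬ ℓ' _ (kept? p ∘ jump) some-jump-cut
  ...   | c , cut = jump c , cut
  find-cut p not-all-kept | yes jumps-kept | no some-down-cut
    with ¬∀⟶∃¬ k' _ (λ a → all? (kept? p ∘ down a)) some-down-cut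
  ...   | a , column-cut with ¬∀⟶∃¬ L _ (kept? p ∘ down a) column-cut
  ...     | c , cut = down a c , cut
  find-cut p not-all-kept | yes jumps-kept | yes downs-kept = ⊥-elim (not-all-kept kept)
    where
    kept : ∀ e → p (source e) ≡ p (target e)
    kept (down a c) = downs-kept a c
    kept (jump c) = jumps-kept c

  cut-exists : ∀ {cap} → cap < N → (p : Placement N L) → Respects cap p → CutBy p
  cut-exists cap<N p p-ok = find-cut p λ kept →
    ℕP.<⇒≱ cap<N (subst (_≤ _) (load-everything p _ (path-connected p kept)) (p-ok _))

  cutRequest : ∀ {cap} → cap < N → (p : Placement N L) → Respects cap p → Request N
  cutRequest cap<N p p-ok = (source e , target e) , λ same → proj₂ (cut-exists cap<N p p-ok) (cong p same)
    where
    e : Edge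
    e = proj₁ (cut-exists cap<N p p-ok)

  cutRequest-separated : ∀ {cap} (cap<N : cap < N) p p-ok → Separates p (cutRequest cap<N p p-ok)
  cutRequest-separated cap<N p p-ok = proj₂ (cut-exists cap<N p p-ok)

  OnPath : Request N → Set
  OnPath r = ∃ λ e → proj₁ r ≡ (source e , target e)

  cutRequest-onPath : ∀ {cap} (cap<N : cap < N) p p-ok → OnPath (cutRequest cap<N p p-ok)
  cutRequest-onPath cap<N p p-ok = proj₁ (cut-exists cap<N p p-ok) , refl

  cut-once : ∀ r → OnPath r → sum (λ j → commCost (offline j) r) ≤ 1
  cut-once r (e , refl) = subst (_≤ 1) (sym (sum-concentrated _ (cutter e) others-keep))
                                (commCost-≤1 (offline (cutter e)) r)
    where
    others-keep : ∀ j → ¬ j ≡ cutter e → commCost (offline j) r ≡ 0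
    others-keep j j≢cutter = commCost-together (offline j) r (λ apart → apart (offline-keeps e j j≢cutter))

  total-cuts : ∀ σ → ListAll.All OnPath σ → sum (λ j → cuts (offline j) σ) ≤ length σ
  total-cuts [] ListAll.[] = ℕP.≤-reflexive (sum-zero {K} (λ _ → 0) (λ _ → refl))
  total-cuts (r ∷ rs) (on ListAll.∷ ons) =
    subst (_≤ suc (length rs)) (sym (∑-distrib-+ (λ j → commCost (offline j) r) (λ j → cuts (offline j) rs)))
      (ℕP.+-mono-≤ (cut-once r on) (total-cuts rs ons))

  best-offline : ∀ σ M → ListAll.All OnPath σ → length σ ≡ K * M → ∃ λ j → cuts (offline j) σ ≤ M
  best-offline σ M on-path σ≡KM =
    averaging (λ j → cuts (offline j) σ) M (subst (sum (λ j → cuts (offline j) σ) ≤_) σ≡KM (total-cuts σ on-path))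

replicate-all : ∀ {A : Set} {P : A → Set} {x} n → P x → VecAll.All P (Vec.replicate n x)
replicate-all zero px = VecAll.[]
replicate-all (suc n) px = px VecAll.∷ replicate-all n px

-- Main theorem: for every deterministic online algorithm A with cluster capacity
-- k ≤ cap < k · ℓ (augmentation δ = cap / k < ℓ) and every c < k, some request
-- sequence σ and capacity-k offline schedule S give c · Off(σ) < On(σ).
theorem3 : (k ℓ cap : ℕ) → k ≤ cap → cap < k * ℓ →
    (α : ℚ) → 1ℚ ℚ.≤ α →
    (init : Placement (k * ℓ) ℓ) → Respects k init →
    (A : OnlineAlg (k * ℓ) ℓ cap) →
    (c : ℚ) → c ℚ.< ℕ→ℚ k →
    Σ (List (Request (k * ℓ))) (λ σ →
      Σ (Vec (Placement (k * ℓ) ℓ) (length σ)) (λ S →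
        VecAll.All (Respects k) S × (c ℚ.* schedCost α init σ S ℚ.< onCost α A init σ)))
theorem3 zero ℓ cap k≤cap ()
theorem3 (suc k') zero cap k≤cap cap<0 = ⊥-elim (ℕP.n≮0 (subst (cap <_) (ℕP.*-zeroʳ (suc k')) cap<0))
theorem3 (suc k') (suc ℓ') cap k≤cap cap<N α 1≤α init init-ok A c c<K =
  σ , S , replicate-all (length σ) (offline-respects j) , ℚP.<-≤-trans c·Off<K·M K·M≤On
  where
  open Snake k' ℓ'
  open Costs α 1≤α
  open AdaptiveAdversary α 1≤α A (cutRequest cap<N) (cutRequest-separated cap<N)
  -- M + 1 adversarial requests per offline placement make the migration overhead negligible
  M : ℕ
  M = proj₁ (enough-rounds k' c (α ℚ.* ℕ→ℚ N) c<K)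
  init-valid : Respects cap init
  init-valid i = ℕP.≤-trans (init-ok i) k≤cap
  σ : List (Request N)
  σ = adversarial (K * suc M) init init-valid []
  best : ∃ λ j → cuts (offline j) σ ≤ suc M
  best = best-offline σ (suc M) (adversarial-all (cutRequest-onPath cap<N) (K * suc M) init init-valid [])
           (adversarial-length (K * suc M) init init-valid [])
  j : Fin K
  j = proj₁ best
  S : Vec (Placement N L) (length σ)
  S = Vec.replicate (length σ) (offline j)
  Off≤ : schedCost α init σ S ℚ.≤ α ℚ.* ℕ→ℚ N ℚ.+ ℕ→ℚ (suc M)
  Off≤ = ℚP.≤-trans (staticCost init (offline j) σ) (ℚP.+-monoʳ-≤ (α ℚ.* ℕ→ℚ N) (ℕ→ℚ-mono-≤ (proj₂ best)))
  c·Off<K·M : c ℚ.* schedCost α init σ S ℚ.< ℕ→ℚ (K * suc M)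
  c·Off<K·M = proj₂ (enough-rounds k' c (α ℚ.* ℕ→ℚ N) c<K) _ (schedCost-nonNeg init σ S) Off≤
  K·M≤On : ℕ→ℚ (K * suc M) ℚ.≤ onCost α A init σ
  K·M≤On = online-≥-rounds (K * suc M) init init-valid []
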